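{- Let $m\geq 1$, $S=\{1,\ldots,2m+1\}$, and let $X$ be the set of all $m$-subsets and all $(m+1)$-subsets of $S$. The doubled Odd graph $2.O_{m+1}$ has vertex set $X$, two distinct vertices $x,y$ being adjacent iff $x\subset y$ or $y\subset x$. Fix $x_0=\{1,\ldots,m\}$ and let $G$ be the stabilizer of $x_0$ in the automorphism group of $2.O_{m+1}$; $G$ acts on $X\times X$ by $\sigma(y,z)=(\sigma y,\sigma z)$. For $y,z\in X$ let $\varrho(y,z)=(|x_0\cap y|,|x_0\cap z|,|y\cap z|,|x_0\cap y\cap z|)$. For $a,b\in\{m,m+1\}$ let $X_{(a,b)}=\{(y,z)\in X\times X: |y|=a,|z|=b\}$, $\mathcal{I}_{(a,b)}=\{\varrho(y,z)\mid (y,z)\in X_{(a,b)}\}$, and for $(i,j,t,p)\in\mathcal{I}_{(a,b)}$ let $X^{(i,j,t,p)}_{(a,b)}=\{(y,z)\in X_{(a,b)}\mid \varrho(y,z)=(i,j,t,p)\}$. Then for each of the four choices $(a,b)\in\{(m,m),(m,m+1),(m+1,m),(m+1,m+1)\}$, the sets $X^{(i,j,t,p)}_{(a,b)}$, $(i,j,t,p)\in\mathcal{I}_{(a,b)}$, are exactly the orbits of $G$ on $X_{(a,b)}$.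
   Context: It is known that the automorphism group of $2.O_{m+1}$ consists of the maps induced by permutations of $S$, composed possibly with complementation $x\mapsto S-x$; in particular the stabilizer of $x_0$ is induced by $\mathrm{Sym}(x_0)\times\mathrm{Sym}(S-x_0)$. -}

module Defs where

open import Data.Nat using (ℕ; zero; suc; _+_; _<ᵇ_)
open import Data.Bool using (Bool)
open import Data.Fin using (Fin; toℕ)
open import Data.Fin.Subset using (Subset; _⊆_; _∩_; ∣_∣)
open import Data.Vec using (tabulate)
open import Data.Product using (Σ; ∃; _×_; _,_; proj₁)
open import Data.Sum using (_⊎_)
open import Relation.Binary.PropositionalEquality using (_≡_; _≢_)
open import Function.Bundles using (_⤖_; Bijection; _⇔_)

-- S = {1,…,2m+1}, modelled as Fin (2m+1) (element i ↔ toℕ i + 1)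
Sz : ℕ → ℕ
Sz m = suc (m + m)

Vertex : ℕ → Set
Vertex m = Σ (Subset (Sz m)) (λ x → ∣ x ∣ ≡ m ⊎ ∣ x ∣ ≡ suc m)

Adj : ∀ {m} → Vertex m → Vertex m → Set
Adj (x , _) (y , _) = x ≢ y × (x ⊆ y ⊎ y ⊆ x)

x₀ : (m : ℕ) → Subset (Sz m)
x₀ m = tabulate (λ i → toℕ i <ᵇ m)

record Aut (m : ℕ) : Set where
  field
    bij : Vertex m ⤖ Vertex m
    adj : ∀ u v → Adj u v ⇔ Adj (Bijection.to bij u) (Bijection.to bij v)

  act : Vertex m → Vertex m
  act = Bijection.to bij

InStab : ∀ {m} → Aut m → Set
InStab {m} σ = ∀ v → proj₁ v ≡ x₀ m → proj₁ (Aut.act σ v) ≡ x₀ m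

ϱ : ∀ {m} → Vertex m → Vertex m → ℕ × ℕ × ℕ × ℕ
ϱ {m} (y , _) (z , _) = ∣ x₀ m ∩ y ∣ , ∣ x₀ m ∩ z ∣ , ∣ y ∩ z ∣ , ∣ x₀ m ∩ (y ∩ z) ∣

SameOrbit : ∀ {m} → Vertex m → Vertex m → Vertex m → Vertex m → Set
SameOrbit {m} y z y' z' =
  Σ (Aut m) (λ σ → InStab σ × Aut.act σ y ≡ y' × Aut.act σ z ≡ z')

{-# OPTIONS --safe #-}
-- Graph distance in 2.O_{m+1} is the Hamming distance ∣ y △ z ∣ (a vertex at distance k + 1 from v
-- has a neighbour at distance k, obtained by adding or removing one point), so automorphisms are
-- isometries. An isometry fixing x₀ preserves the distances between x₀, y and z, and with the
-- sizes of y and z these give the first three entries of ϱ. For the fourth, look at the vertices w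
-- lying on a geodesic from x₀ to y and on one from x₀ to z: such a w can only remove points of
-- x₀ ∖ (y ∪ z) (there are α of them) and add points of (y ∩ z) ∖ x₀ (β of them), and its size is
-- m or m + 1, so the largest distance from x₀ to such a w is min (2β, 2α + 1). The stabiliser
-- preserves this maximum; since α + β is known from the other entries, parity determines α,
-- hence ∣ x₀ ∩ y ∩ z ∣. Conversely, if ϱ agrees then by inclusion–exclusion the eight Venn regions
-- of (x₀, y, z) and (x₀, y′, z′) have the same sizes, and a permutation of S matching them region
-- by region induces an automorphism fixing x₀ that sends (y, z) to (y′, z′).

module Submission where

open import Defs
open import Algebra.Properties.CommutativeMonoid.Sum as ∑ using ()
open import Data.Bool using (Bool; true; false; not; _∧_; _∨_; _xor_; T) renaming (_≟_ to _≟ᵇ_)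
open import Data.Bool.Properties using (T-∧; T-≡; xor-same; xor-comm; ¬-not)
open import Data.Empty using (⊥-elim)
open import Data.Fin using (Fin; zero; suc; punchIn; toℕ)
open import Data.Fin.Permutation as Perm using (Permutation; _⟨$⟩ʳ_)
open import Data.Fin.Properties using (punchInᵢ≢i; _≟_; any?)
open import Data.Fin.Subset using (Subset; _⊆_; _∩_; ∣_∣)
open import Data.List using (List; []; _∷_; foldr; map)
open import Data.Nat using (ℕ; zero; suc; _+_; _*_; _⊓_; _≤_; _<_; z≤n; s≤s; _≤?_; _≡ᵇ_; _≤ᵇ_; _<ᵇ_)
open import Data.Nat.Properties
  using ( ≡ᵇ⇒≡; ≤ᵇ⇒≤; ≡-irrelevant; suc-injective; 0≢1+n; 1+n≢n; ≤-refl; ≤-reflexive; ≤-trans; ≤-antisym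
        ; ≤-pred; n≤1+n; m≤n⇒m≤1+n; m≤m+n; <⇒≤; ≰⇒>; n≤0⇒n≡0; module ≤-Reasoning
        ; +-comm; +-identityʳ; +-suc; +-cancelˡ-≡; +-cancelʳ-≡; +-cancelʳ-≤; +-mono-≤; +-monoˡ-≤; +-monoʳ-≤
        ; m+n≡0⇒m≡0; m+n≡0⇒n≡0; *-cancelˡ-≡; even≢odd; ⊓-sel; ⊓-glb; m≤n⇒m⊓n≡m; m≥n⇒m⊓n≡n; +-0-commutativeMonoid )
open import Data.Nat.Tactic.RingSolver using (solve-∀)
open import Data.Product using (Σ; ∃; _×_; _,_; proj₁; proj₂)
open import Data.Product.Properties using (≡-dec)
open import Data.Sum as Sum using (_⊎_; inj₁; inj₂)
open import Data.Vec using ([]; _∷_; lookup; tabulate; _[_]≔_)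
open import Data.Vec.Properties
  using (lookup∘tabulate; tabulate∘lookup; tabulate-cong; lookup-zipWith; lookup∘update; lookup∘update′; []=⇒lookup; lookup⇒[]=)
open import Function using (_∘_; case_of_; _⇔_; Equivalence; Inverse; mk⇔; mk↔ₛ′)
open import Function.Properties.Bijection using (⤖⇒↔)
open import Function.Properties.Inverse using (↔⇒⤖)
open import Relation.Binary.Definitions using (DecidableEquality)
open import Relation.Binary.PropositionalEquality
open import Relation.Nullary using (contradiction; yes; no; _×-dec_)
open import Relation.Nullary.Decidable using (⌊_⌋; toWitness; fromWitness)

open ∑ +-0-commutativeMonoid using (sum; sum-syntax; sum-replicate-zero; ∑-distrib-+; sum-cong-≗; sum-remove; sum-permute)

χ : Bool → ℕ
χ true  = 1
χ false = 0

count : ∀ {n} → (Fin n → Bool) → ℕ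
count b = sum (χ ∘ b)

sum-mono-≤ : ∀ {n} {f g : Fin n → ℕ} → (∀ i → f i ≤ g i) → sum f ≤ sum g
sum-mono-≤ {zero}  f≤g = z≤n
sum-mono-≤ {suc n} f≤g = +-mono-≤ (f≤g zero) (sum-mono-≤ (f≤g ∘ suc))

sum≡0⇒≡0 : ∀ {n} (f : Fin n → ℕ) → sum f ≡ 0 → ∀ i → f i ≡ 0
sum≡0⇒≡0 f Σf≡0 zero    = m+n≡0⇒m≡0 (f zero) Σf≡0
sum≡0⇒≡0 f Σf≡0 (suc i) = sum≡0⇒≡0 (f ∘ suc) (m+n≡0⇒n≡0 (f zero) Σf≡0) i

count>0⇒∃ : ∀ {n} (b : Fin n → Bool) → 0 < count b → ∃ λ i → T (b i)
count>0⇒∃ {suc n} b pos with b zero in b₀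
... | true  = zero , Equivalence.from T-≡ b₀
... | false = let i , bᵢ = count>0⇒∃ (b ∘ suc) pos in suc i , bᵢ

∃-subset-of-size : ∀ {n} k (r : Fin n → Bool) → k ≤ count r → Σ (Fin n → Bool) λ s → count (λ i → s i ∧ r i) ≡ k
∃-subset-of-size {n}     zero    r _ = (λ _ → false) , sum-replicate-zero n
∃-subset-of-size {zero}  (suc k) r ()
∃-subset-of-size {suc n} (suc k) r k< with r zero
... | true  = let s , ∣s∣ = ∃-subset-of-size k (r ∘ suc) (≤-pred k<) in (λ { zero → true ; (suc i) → s i }) , cong suc ∣s∣
... | false = let s , ∣s∣ = ∃-subset-of-size (suc k) (r ∘ suc) k<    in (λ { zero → false ; (suc i) → s i }) , ∣s∣

sum-update : ∀ {n} (t u : Fin (suc n) → ℕ) i → (∀ j → j ≢ i → t j ≡ u j) → sum t + u i ≡ sum u + t i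
sum-update t u i t≡u = begin
  sum t + u i                      ≡⟨ cong (_+ u i) (sum-remove {i = i} t) ⟩
  t i + sum (t ∘ punchIn i) + u i  ≡⟨ cong (λ s → t i + s + u i) (sum-cong-≗ λ j → t≡u _ (punchInᵢ≢i i j)) ⟩
  t i + sum (u ∘ punchIn i) + u i  ≡⟨ swap-outer (t i) _ (u i) ⟩
  u i + sum (u ∘ punchIn i) + t i  ≡⟨ cong (_+ t i) (sum-remove {i = i} u) ⟨
  sum u + t i                      ∎
  where
  open ≡-Reasoning
  swap-outer : ∀ a s b → a + s + b ≡ b + s + a
  swap-outer = solve-∀

∣p∣≡count : ∀ {n} (p : Subset n) → ∣ p ∣ ≡ count (lookup p)
∣p∣≡count []            = refl
∣p∣≡count (true  ∷ p) = cong suc (∣p∣≡count p)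
∣p∣≡count (false ∷ p) = ∣p∣≡count p

∣p∩q∣≡count : ∀ {n} (p q : Subset n) → ∣ p ∩ q ∣ ≡ count (λ i → lookup p i ∧ lookup q i)
∣p∩q∣≡count p q = trans (∣p∣≡count (p ∩ q)) (sum-cong-≗ (cong χ ∘ λ i → lookup-zipWith _∧_ i p q))

∣p∩q∩r∣≡count : ∀ {n} (p q r : Subset n) → ∣ p ∩ (q ∩ r) ∣ ≡ count (λ i → lookup p i ∧ (lookup q i ∧ lookup r i))
∣p∩q∩r∣≡count p q r =
  trans (∣p∩q∣≡count p (q ∩ r)) (sum-cong-≗ λ i → cong (λ b → χ (lookup p i ∧ b)) (lookup-zipWith _∧_ i q r))

lookup-injective : ∀ {n} {p q : Subset n} → (∀ i → lookup p i ≡ lookup q i) → p ≡ q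
lookup-injective {p = p} {q} eq =
  trans (sym (tabulate∘lookup p)) (trans (tabulate-cong eq) (tabulate∘lookup q))

⊆⇒lookup : ∀ {n} {p q : Subset n} → p ⊆ q → ∀ i → lookup p i ≡ true → lookup q i ≡ true
⊆⇒lookup {p = p} p⊆q i pᵢ = []=⇒lookup (p⊆q (lookup⇒[]= i p pᵢ))

lookup⇒⊆ : ∀ {n} {p q : Subset n} → (∀ i → lookup p i ≡ true → lookup q i ≡ true) → p ⊆ q
lookup⇒⊆ {q = q} p⇒q {i} i∈p = lookup⇒[]= i q (p⇒q i ([]=⇒lookup i∈p))

-- Identities between functions of k Booleans, decided by evaluating both sides at all 2ᵏ inputs.
BoolOp : ℕ → Set → Set
BoolOp zero    A = A
BoolOp (suc k) A = Bool → BoolOp k A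

every : ∀ k → BoolOp k Bool → Bool
every zero    b = b
every (suc k) P = every k (P true) ∧ every k (P false)

zipOp : ∀ k {A B C : Set} → (A → B → C) → BoolOp k A → BoolOp k B → BoolOp k C
zipOp zero    _∙_ a b = a ∙ b
zipOp (suc k) _∙_ f g = λ x → zipOp k _∙_ (f x) (g x)

Pointwise : ∀ k → (ℕ → ℕ → Set) → BoolOp k ℕ → BoolOp k ℕ → Set
Pointwise zero    R m n = R m n
Pointwise (suc k) R f g = ∀ x → Pointwise k R (f x) (g x)

by-truth-table : ∀ k {R : ℕ → ℕ → Set} {R? : ℕ → ℕ → Bool} → (∀ m n → T (R? m n) → R m n) →
                 {f g : BoolOp k ℕ} → T (every k (zipOp k R? f g)) → Pointwise k R f g
by-truth-table zero    sound h = sound _ _ h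
by-truth-table (suc k) sound h true = by-truth-table k sound (proj₁ (Equivalence.to T-∧ h))
by-truth-table (suc k) {R? = R?} sound {f} {g} h false =
  by-truth-table k sound (proj₂ (Equivalence.to (T-∧ {every k (zipOp k R? (f true) (g true))}) h))

≡-by-truth-table : ∀ k {f g : BoolOp k ℕ} → {T (every k (zipOp k _≡ᵇ_ f g))} → Pointwise k _≡_ f g
≡-by-truth-table k {f} {g} {h} = by-truth-table k ≡ᵇ⇒≡ h

≤-by-truth-table : ∀ k {f g : BoolOp k ℕ} → {T (every k (zipOp k _≤ᵇ_ f g))} → Pointwise k _≤_ f g
≤-by-truth-table k {f} {g} {h} = by-truth-table k ≤ᵇ⇒≤ h

dist : ∀ {n} → Subset n → Subset n → ℕ
dist p q = count (λ i → lookup p i xor lookup q i)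

dist-refl : ∀ {n} (p : Subset n) → dist p p ≡ 0
dist-refl {n} p = trans (sum-cong-≗ (λ i → cong χ (xor-same (lookup p i)))) (sum-replicate-zero n)

dist≡0⇒≡ : ∀ {n} (p q : Subset n) → dist p q ≡ 0 → p ≡ q
dist≡0⇒≡ p q d≡0 = lookup-injective λ i → χxor≡0⇒≡ (lookup p i) (lookup q i) (sum≡0⇒≡0 _ d≡0 i)
  where
  χxor≡0⇒≡ : ∀ a b → χ (a xor b) ≡ 0 → a ≡ b
  χxor≡0⇒≡ true  true  _ = refl
  χxor≡0⇒≡ false false _ = refl

dist-sym : ∀ {n} (p q : Subset n) → dist p q ≡ dist q p
dist-sym p q = sum-cong-≗ λ i → cong χ (xor-comm (lookup p i) (lookup q i))

dist-triangle : ∀ {n} (p q r : Subset n) → dist p r ≤ dist p q + dist q r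
dist-triangle {n} p q r = begin
  dist p r                                                ≤⟨ sum-mono-≤ (λ i → triangle (lookup p i) (lookup q i) (lookup r i)) ⟩
  ∑[ i < n ] (χ (lookup p i xor lookup q i) + χ (lookup q i xor lookup r i)) ≡⟨ ∑-distrib-+ {n} _ _ ⟩
  dist p q + dist q r                                     ∎
  where
  open ≤-Reasoning
  triangle : ∀ a b c → χ (a xor c) ≤ χ (a xor b) + χ (b xor c)
  triangle = ≤-by-truth-table 3

∣p[i]≔b∣ : ∀ {n} (p : Subset (suc n)) i b → ∣ p [ i ]≔ b ∣ + χ (lookup p i) ≡ ∣ p ∣ + χ b
∣p[i]≔b∣ p i b = begin
  ∣ p [ i ]≔ b ∣ + χ (lookup p i)          ≡⟨ cong (_+ χ (lookup p i)) (∣p∣≡count (p [ i ]≔ b)) ⟩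
  count (lookup (p [ i ]≔ b)) + χ (lookup p i)
    ≡⟨ sum-update (χ ∘ lookup (p [ i ]≔ b)) (χ ∘ lookup p) i (λ j j≢i → cong χ (lookup∘update′ j≢i p b)) ⟩
  count (lookup p) + χ (lookup (p [ i ]≔ b) i) ≡⟨ cong₂ _+_ (∣p∣≡count p) (cong χ (sym (lookup∘update i p b))) ⟨
  ∣ p ∣ + χ b                              ∎
  where open ≡-Reasoning

dist-step : ∀ {n} (p q : Subset (suc n)) i → lookup p i ≢ lookup q i →
            dist p q ≡ suc (dist (p [ i ]≔ lookup q i) q)
dist-step p q i pᵢ≢qᵢ = begin
  dist p q                                   ≡⟨ +-identityʳ _ ⟨
  dist p q + 0                               ≡⟨ cong (λ b → dist p q + χ b) (xor-same (lookup q i)) ⟨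
  dist p q + χ (lookup q i xor lookup q i)   ≡⟨ cong (λ b → dist p q + χ (b xor lookup q i)) (lookup∘update i p _) ⟨
  dist p q + χ (lookup p′ i xor lookup q i)  ≡⟨ sum-update (term p) (term p′) i agree-off-i ⟩
  dist p′ q + χ (lookup p i xor lookup q i)  ≡⟨ cong (dist p′ q +_) (χ-xor-≢ pᵢ≢qᵢ) ⟩
  dist p′ q + 1                              ≡⟨ +-comm _ 1 ⟩
  suc (dist p′ q)                            ∎
  where
  open ≡-Reasoning
  p′ : Subset _
  p′ = p [ i ]≔ lookup q i
  term : Subset _ → Fin _ → ℕ
  term r j = χ (lookup r j xor lookup q j)
  agree-off-i : ∀ j → j ≢ i → term p j ≡ term p′ j
  agree-off-i j j≢i = cong (λ b → χ (b xor lookup q j)) (sym (lookup∘update′ j≢i p _))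
  χ-xor-≢ : ∀ {a b} → a ≢ b → χ (a xor b) ≡ 1
  χ-xor-≢ {true}  {true}  a≢b = contradiction refl a≢b
  χ-xor-≢ {true}  {false} _   = refl
  χ-xor-≢ {false} {true}  _   = refl
  χ-xor-≢ {false} {false} a≢b = contradiction refl a≢b

⊆⇒dist+∣p∣≡∣q∣ : ∀ {n} {p q : Subset n} → p ⊆ q → dist p q + ∣ p ∣ ≡ ∣ q ∣
⊆⇒dist+∣p∣≡∣q∣ {p = p} {q} p⊆q = begin
  dist p q + ∣ p ∣                                  ≡⟨ cong (dist p q +_) (∣p∣≡count p) ⟩
  dist p q + count (lookup p)                       ≡⟨ ∑-distrib-+ (λ i → χ (lookup p i xor lookup q i)) (χ ∘ lookup p) ⟨
  sum (λ i → χ (lookup p i xor lookup q i) + χ (lookup p i)) ≡⟨ sum-cong-≗ pointwise ⟩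
  count (lookup q)                                  ≡⟨ ∣p∣≡count q ⟨
  ∣ q ∣                                             ∎
  where
  open ≡-Reasoning
  pointwise : ∀ i → χ (lookup p i xor lookup q i) + χ (lookup p i) ≡ χ (lookup q i)
  pointwise i with lookup p i in pᵢ
  ... | true  rewrite ⊆⇒lookup p⊆q i pᵢ = refl
  ... | false = +-identityʳ _

⊆⇒dist≡0 : ∀ {n} {p q : Subset n} → p ⊆ q → ∣ q ∣ ≤ ∣ p ∣ → dist p q ≡ 0
⊆⇒dist≡0 {p = p} {q} p⊆q ∣q∣≤∣p∣ =
  n≤0⇒n≡0 (+-cancelʳ-≤ ∣ p ∣ (dist p q) 0 (≤-trans (≤-reflexive (⊆⇒dist+∣p∣≡∣q∣ p⊆q)) ∣q∣≤∣p∣))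

∣p∣+∣q∣≡dist+2∣p∩q∣ : ∀ {n} (p q : Subset n) → ∣ p ∣ + ∣ q ∣ ≡ dist p q + (∣ p ∩ q ∣ + ∣ p ∩ q ∣)
∣p∣+∣q∣≡dist+2∣p∩q∣ {n} p q = begin
  ∣ p ∣ + ∣ q ∣                                           ≡⟨ cong₂ _+_ (∣p∣≡count p) (∣p∣≡count q) ⟩
  count (lookup p) + count (lookup q)                     ≡⟨ ∑-distrib-+ {n} _ _ ⟨
  ∑[ i < n ] (χ (lookup p i) + χ (lookup q i))            ≡⟨ sum-cong-≗ (λ i → pointwise (lookup p i) (lookup q i)) ⟩
  ∑[ i < n ] (χ (lookup p i xor lookup q i) + (χ (lookup p i ∧ lookup q i) + χ (lookup p i ∧ lookup q i)))
    ≡⟨ ∑-distrib-+ {n} _ _ ⟩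
  dist p q + ∑[ i < n ] (χ (lookup p i ∧ lookup q i) + χ (lookup p i ∧ lookup q i))
    ≡⟨ cong (dist p q +_) (∑-distrib-+ {n} _ _) ⟩
  dist p q + (count (λ i → lookup p i ∧ lookup q i) + count (λ i → lookup p i ∧ lookup q i))
    ≡⟨ cong (λ c → dist p q + (c + c)) (∣p∩q∣≡count p q) ⟨
  dist p q + (∣ p ∩ q ∣ + ∣ p ∩ q ∣)                     ∎
  where
  open ≡-Reasoning
  pointwise : ∀ a b → χ a + χ b ≡ χ (a xor b) + (χ (a ∧ b) + χ (a ∧ b))
  pointwise = ≡-by-truth-table 2

+-double-injective : ∀ {a b} → a + a ≡ b + b → a ≡ b
+-double-injective {a} {b} a+a≡b+b =
  *-cancelˡ-≡ a b 2 (trans (cong (a +_) (+-identityʳ a)) (trans a+a≡b+b (cong (b +_) (sym (+-identityʳ b)))))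

∣p∩q∣-determined-by-dist : ∀ {n} (p q p′ q′ : Subset n) → ∣ p ∣ + ∣ q ∣ ≡ ∣ p′ ∣ + ∣ q′ ∣ → dist p q ≡ dist p′ q′ →
                           ∣ p ∩ q ∣ ≡ ∣ p′ ∩ q′ ∣
∣p∩q∣-determined-by-dist p q p′ q′ sizes dists = +-double-injective (+-cancelˡ-≡ (dist p q) _ _ (begin
  dist p q + (∣ p ∩ q ∣ + ∣ p ∩ q ∣)       ≡⟨ ∣p∣+∣q∣≡dist+2∣p∩q∣ p q ⟨
  ∣ p ∣ + ∣ q ∣                            ≡⟨ sizes ⟩
  ∣ p′ ∣ + ∣ q′ ∣                          ≡⟨ ∣p∣+∣q∣≡dist+2∣p∩q∣ p′ q′ ⟩
  dist p′ q′ + (∣ p′ ∩ q′ ∣ + ∣ p′ ∩ q′ ∣) ≡⟨ cong (_+ _) dists ⟨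
  dist p q + (∣ p′ ∩ q′ ∣ + ∣ p′ ∩ q′ ∣)   ∎))
  where open ≡-Reasoning

removed : ∀ {n} → Subset n → Subset n → ℕ
removed p q = count (λ i → lookup p i ∧ not (lookup q i))

dist≡removed+added : ∀ {n} (p q : Subset n) → dist p q ≡ removed p q + removed q p
dist≡removed+added {n} p q = trans (sum-cong-≗ λ i → pointwise (lookup p i) (lookup q i)) (∑-distrib-+ {n} _ _)
  where
  pointwise : ∀ a b → χ (a xor b) ≡ χ (a ∧ not b) + χ (b ∧ not a)
  pointwise = ≡-by-truth-table 2

∣q∣+removed≡∣p∣+added : ∀ {n} (p q : Subset n) → ∣ q ∣ + removed p q ≡ ∣ p ∣ + removed q p
∣q∣+removed≡∣p∣+added {n} p q = begin
  ∣ q ∣ + removed p q                                   ≡⟨ cong (_+ removed p q) (∣p∣≡count q) ⟩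
  count (lookup q) + removed p q                        ≡⟨ ∑-distrib-+ {n} _ _ ⟨
  ∑[ i < n ] (χ (lookup q i) + χ (lookup p i ∧ not (lookup q i)))
    ≡⟨ sum-cong-≗ (λ i → pointwise (lookup p i) (lookup q i)) ⟩
  ∑[ i < n ] (χ (lookup p i) + χ (lookup q i ∧ not (lookup p i))) ≡⟨ ∑-distrib-+ {n} _ _ ⟩
  count (lookup p) + removed q p                        ≡⟨ cong (_+ removed q p) (∣p∣≡count p) ⟨
  ∣ p ∣ + removed q p                                   ∎
  where
  open ≡-Reasoning
  pointwise : ∀ a b → χ b + χ (a ∧ not b) ≡ χ a + χ (b ∧ not a)
  pointwise = ≡-by-truth-table 2

detour : ∀ {n} → Subset n → Subset n → Subset n → ℕ
detour p q w = count (λ i → not (lookup p i xor lookup q i) ∧ (lookup p i xor lookup w i))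

dist-via≡dist+2detour : ∀ {n} (p q w : Subset n) → dist p w + dist w q ≡ dist p q + (detour p q w + detour p q w)
dist-via≡dist+2detour {n} p q w = begin
  dist p w + dist w q                                   ≡⟨ ∑-distrib-+ {n} _ _ ⟨
  ∑[ i < n ] (χ (lookup p i xor lookup w i) + χ (lookup w i xor lookup q i))
    ≡⟨ sum-cong-≗ (λ i → pointwise (lookup p i) (lookup q i) (lookup w i)) ⟩
  ∑[ i < n ] (χ (lookup p i xor lookup q i) + (d i + d i)) ≡⟨ ∑-distrib-+ {n} _ _ ⟩
  dist p q + ∑[ i < n ] (d i + d i)                       ≡⟨ cong (dist p q +_) (∑-distrib-+ {n} d d) ⟩
  dist p q + (detour p q w + detour p q w)              ∎
  where
  open ≡-Reasoning
  d : Fin n → ℕ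
  d i = χ (not (lookup p i xor lookup q i) ∧ (lookup p i xor lookup w i))
  pointwise : ∀ a b c → χ (a xor c) + χ (c xor b) ≡ χ (a xor b) + (χ (not (a xor b) ∧ (a xor c)) + χ (not (a xor b) ∧ (a xor c)))
  pointwise = ≡-by-truth-table 3

on-geodesic⇒detour≡0 : ∀ {n} (p q w : Subset n) → dist p w + dist w q ≡ dist p q → detour p q w ≡ 0
on-geodesic⇒detour≡0 p q w geo = m+n≡0⇒m≡0 _ (+-cancelˡ-≡ (dist p q) _ 0
  (trans (sym (dist-via≡dist+2detour p q w)) (trans geo (sym (+-identityʳ _)))))

Vertex-≡ : ∀ {m} {u v : Vertex m} → proj₁ u ≡ proj₁ v → u ≡ v
Vertex-≡ {u = p , s} {.p , t} refl = cong (p ,_) (size-irrelevant s t)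
  where
  size-irrelevant : ∀ {k m} (s t : k ≡ m ⊎ k ≡ suc m) → s ≡ t
  size-irrelevant (inj₁ s) (inj₁ t) = cong inj₁ (≡-irrelevant s t)
  size-irrelevant (inj₂ s) (inj₂ t) = cong inj₂ (≡-irrelevant s t)
  size-irrelevant (inj₁ s) (inj₂ t) = ⊥-elim (1+n≢n (sym (trans (sym s) t)))
  size-irrelevant (inj₂ s) (inj₁ t) = ⊥-elim (1+n≢n (sym (trans (sym t) s)))

size-bounds : ∀ {m} (u : Vertex m) → m ≤ ∣ proj₁ u ∣ × ∣ proj₁ u ∣ ≤ suc m
size-bounds (_ , inj₁ ∣u∣≡m)  = ≤-reflexive (sym ∣u∣≡m) , m≤n⇒m≤1+n (≤-reflexive ∣u∣≡m)
size-bounds (_ , inj₂ ∣u∣≡1+m) = ≤-trans (n≤1+n _) (≤-reflexive (sym ∣u∣≡1+m)) , ≤-reflexive ∣u∣≡1+m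

distᵥ : ∀ {m} → Vertex m → Vertex m → ℕ
distᵥ u v = dist (proj₁ u) (proj₁ v)

⊆⇒distᵥ≤1 : ∀ {m} (u v : Vertex m) → proj₁ u ⊆ proj₁ v → distᵥ u v ≤ 1
⊆⇒distᵥ≤1 {m} u v u⊆v = +-cancelʳ-≤ m (distᵥ u v) 1 (begin
  distᵥ u v + m              ≤⟨ +-monoʳ-≤ (distᵥ u v) (proj₁ (size-bounds u)) ⟩
  distᵥ u v + ∣ proj₁ u ∣    ≡⟨ ⊆⇒dist+∣p∣≡∣q∣ u⊆v ⟩
  ∣ proj₁ v ∣                ≤⟨ proj₂ (size-bounds v) ⟩
  1 + m                      ∎)
  where open ≤-Reasoning

Adj⇒distᵥ≡1 : ∀ {m} (u v : Vertex m) → Adj u v → distᵥ u v ≡ 1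
Adj⇒distᵥ≡1 u v (u≢v , inclusion) with distᵥ u v in d | inclusion
... | 0 | _ = ⊥-elim (u≢v (dist≡0⇒≡ _ _ d))
... | 1 | _ = refl
... | suc (suc _) | inj₁ u⊆v = contradiction (subst (_≤ 1) d (⊆⇒distᵥ≤1 u v u⊆v)) λ { (s≤s ()) }
... | suc (suc _) | inj₂ v⊆u = contradiction (subst (_≤ 1) (trans (dist-sym (proj₁ v) (proj₁ u)) d) (⊆⇒distᵥ≤1 v u v⊆u)) λ { (s≤s ()) }

⊆-[]≔true : ∀ {n} (p : Subset n) i → p ⊆ p [ i ]≔ true
⊆-[]≔true p i = lookup⇒⊆ λ j pⱼ → case j ≟ i of λ where
  (yes refl) → lookup∘update i p true
  (no j≢i)   → trans (lookup∘update′ j≢i p true) pⱼ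

[]≔false-⊆ : ∀ {n} (p : Subset n) i → p [ i ]≔ false ⊆ p
[]≔false-⊆ p i = lookup⇒⊆ λ j p′ⱼ → case j ≟ i of λ where
  (yes refl) → contradiction (trans (sym (lookup∘update i p false)) p′ⱼ) λ ()
  (no j≢i)   → trans (sym (lookup∘update′ j≢i p false)) p′ⱼ

Adj-[]≔ : ∀ {m} (u : Vertex m) i b {sp′} → lookup (proj₁ u) i ≢ b → Adj u (proj₁ u [ i ]≔ b , sp′)
Adj-[]≔ (p , _) i b pᵢ≢b = p≢p′ , inclusion b
  where
  p≢p′ : p ≢ p [ i ]≔ b
  p≢p′ p≡p′ = pᵢ≢b (trans (cong (λ r → lookup r i) p≡p′) (lookup∘update i p b))
  inclusion : ∀ b → p ⊆ p [ i ]≔ b ⊎ p [ i ]≔ b ⊆ p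
  inclusion true  = inj₁ (⊆-[]≔true p i)
  inclusion false = inj₂ ([]≔false-⊆ p i)

≡-not-≡⇒≢ : ∀ {a c} b → a ≡ b → c ≡ not b → a ≢ c
≡-not-≡⇒≢ true  refl refl ()
≡-not-≡⇒≢ false refl refl ()

neighbour-towards : ∀ {m} (u v : Vertex m) i → lookup (proj₁ u) i ≢ lookup (proj₁ v) i → ∀ {sp′ k} →
                    distᵥ u v ≡ suc k → Σ (Vertex m) λ u′ → Adj u u′ × distᵥ u′ v ≡ k
neighbour-towards u@(p , _) v@(q , _) i pᵢ≢qᵢ {sp′} d =
  (p [ i ]≔ lookup q i , sp′) , Adj-[]≔ u i (lookup q i) {sp′} pᵢ≢qᵢ , suc-injective (trans (sym (dist-step p q i pᵢ≢qᵢ)) d)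

distᵥ-suc⇒neighbour : ∀ {m} (u v : Vertex m) {k} → distᵥ u v ≡ suc k →
                      Σ (Vertex m) λ u′ → Adj u u′ × distᵥ u′ v ≡ k
distᵥ-suc⇒neighbour {m} u@(p , inj₁ ∣p∣≡m) v@(q , _) d
  with any? (λ i → (lookup p i ≟ᵇ false) ×-dec (lookup q i ≟ᵇ true))
... | yes (i , pᵢ , qᵢ) = neighbour-towards u v i (≡-not-≡⇒≢ false pᵢ qᵢ) {inj₂ grows} d
  where
  grows : ∣ p [ i ]≔ lookup q i ∣ ≡ suc m
  grows = +-cancelʳ-≡ 0 _ _ (trans (subst₂ (λ a b → ∣ p [ i ]≔ lookup q i ∣ + χ a ≡ ∣ p ∣ + χ b) pᵢ qᵢ (∣p[i]≔b∣ p i _))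
                                 (trans (cong (_+ 1) ∣p∣≡m) (trans (+-comm m 1) (sym (+-identityʳ _)))))
... | no none = contradiction (trans (dist-sym p q) (⊆⇒dist≡0 q⊆p ∣p∣≤∣q∣)) λ d≡0 → 0≢1+n (trans (sym d≡0) d)
  where
  q⊆p : q ⊆ p
  q⊆p = lookup⇒⊆ λ i qᵢ → ¬-not λ pᵢ → none (i , pᵢ , qᵢ)
  ∣p∣≤∣q∣ : ∣ p ∣ ≤ ∣ q ∣
  ∣p∣≤∣q∣ = subst (_≤ ∣ q ∣) (sym ∣p∣≡m) (proj₁ (size-bounds v))
distᵥ-suc⇒neighbour {m} u@(p , inj₂ ∣p∣≡1+m) v@(q , _) d
  with any? (λ i → (lookup p i ≟ᵇ true) ×-dec (lookup q i ≟ᵇ false))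
... | yes (i , pᵢ , qᵢ) = neighbour-towards u v i (≡-not-≡⇒≢ true pᵢ qᵢ) {inj₁ shrinks} d
  where
  shrinks : ∣ p [ i ]≔ lookup q i ∣ ≡ m
  shrinks = +-cancelʳ-≡ 1 _ _ (trans (subst₂ (λ a b → ∣ p [ i ]≔ lookup q i ∣ + χ a ≡ ∣ p ∣ + χ b) pᵢ qᵢ (∣p[i]≔b∣ p i _))
                                   (trans (+-identityʳ _) (trans ∣p∣≡1+m (+-comm 1 m))))
... | no none = contradiction (⊆⇒dist≡0 p⊆q ∣q∣≤∣p∣) λ d≡0 → 0≢1+n (trans (sym d≡0) d)
  where
  p⊆q : p ⊆ q
  p⊆q = lookup⇒⊆ λ i pᵢ → ¬-not λ qᵢ → none (i , pᵢ , qᵢ)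
  ∣q∣≤∣p∣ : ∣ q ∣ ≤ ∣ p ∣
  ∣q∣≤∣p∣ = subst (∣ q ∣ ≤_) (sym ∣p∣≡1+m) (proj₂ (size-bounds v))

adjacency-preserving⇒distᵥ-≤ : ∀ {m} (f : Vertex m → Vertex m) → (∀ u v → Adj u v → Adj (f u) (f v)) →
                               ∀ u v → distᵥ (f u) (f v) ≤ distᵥ u v
adjacency-preserving⇒distᵥ-≤ f f-adj u v = go _ u v refl
  where
  go : ∀ k u v → distᵥ u v ≡ k → distᵥ (f u) (f v) ≤ k
  go zero    u v d rewrite Vertex-≡ {u = u} {v} (dist≡0⇒≡ _ _ d) = ≤-reflexive (dist-refl (proj₁ (f v)))
  go (suc k) u v d with distᵥ-suc⇒neighbour u v d
  ... | u′ , u~u′ , d′ = begin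
    distᵥ (f u) (f v)                        ≤⟨ dist-triangle (proj₁ (f u)) (proj₁ (f u′)) (proj₁ (f v)) ⟩
    distᵥ (f u) (f u′) + distᵥ (f u′) (f v)  ≡⟨ cong (_+ distᵥ (f u′) (f v)) (Adj⇒distᵥ≡1 (f u) (f u′) (f-adj u u′ u~u′)) ⟩
    suc (distᵥ (f u′) (f v))                 ≤⟨ s≤s (go k u′ v d′) ⟩
    suc k                                    ∎
    where open ≤-Reasoning

Aut-preserves-distᵥ : ∀ {m} (σ : Aut m) u v → distᵥ (Aut.act σ u) (Aut.act σ v) ≡ distᵥ u v
Aut-preserves-distᵥ σ u v = ≤-antisym
  (adjacency-preserving⇒distᵥ-≤ to (λ u v → Equivalence.to (adj u v)) u v)
  (subst₂ (λ u′ v′ → distᵥ u′ v′ ≤ distᵥ (to u) (to v)) (strictlyInverseʳ u) (strictlyInverseʳ v)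
    (adjacency-preserving⇒distᵥ-≤ from from-adj (to u) (to v)))
  where
  open Aut σ using (adj)
  open Inverse (⤖⇒↔ (Aut.bij σ))
  from-adj : ∀ u v → Adj u v → Adj (from u) (from v)
  from-adj u v u~v = Equivalence.from (adj (from u) (from v)) (subst₂ Adj (sym (strictlyInverseˡ u)) (sym (strictlyInverseˡ v)) u~v)

-- Vertices on geodesics from X to both Y and Z

removal-addition-bound : ∀ {m w r a α β} → w + r ≡ m + a → w ≡ m ⊎ w ≡ suc m → r ≤ α → a ≤ β →
                         r + a ≤ (β + β) ⊓ suc (α + α)
removal-addition-bound {m} {r = r} {a} w+r≡m+a (inj₁ refl) r≤α a≤β
  with refl ← +-cancelˡ-≡ m r a w+r≡m+a =
  ⊓-glb (+-mono-≤ a≤β a≤β) (m≤n⇒m≤1+n (+-mono-≤ r≤α r≤α))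
removal-addition-bound {m} {r = r} {a} w+r≡m+a (inj₂ refl) r≤α a≤β
  with refl ← +-cancelˡ-≡ m (suc r) a (trans (+-suc m r) w+r≡m+a) =
  ⊓-glb (≤-trans (+-monoˡ-≤ (suc r) (n≤1+n r)) (+-mono-≤ a≤β a≤β))
        (≤-trans (≤-reflexive (+-suc r r)) (s≤s (+-mono-≤ r≤α r≤α)))

double≢odd : ∀ a b → a + a ≢ suc (b + b)
double≢odd a b eq = even≢odd a b (trans (sym (double a)) (trans eq (cong suc (double b))))
  where
  double : ∀ a → a + a ≡ 2 * a
  double a = cong (a +_) (sym (+-identityʳ a))

μ-injective : ∀ {α β α′ β′} → α + β ≡ α′ + β′ → (β + β) ⊓ suc (α + α) ≡ (β′ + β′) ⊓ suc (α′ + α′) → α ≡ α′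
μ-injective {α} {β} {α′} {β′} sums μ≡μ′ with ⊓-sel (β + β) (suc (α + α)) | ⊓-sel (β′ + β′) (suc (α′ + α′))
... | inj₁ μ≡2β | inj₁ μ′≡2β′ = +-cancelʳ-≡ β α α′ (trans sums (cong (α′ +_) (sym β≡β′)))
  where
  β≡β′ : β ≡ β′
  β≡β′ = +-double-injective (trans (sym μ≡2β) (trans μ≡μ′ μ′≡2β′))
... | inj₂ μ≡1+2α | inj₂ μ′≡1+2α′ = +-double-injective (suc-injective (trans (sym μ≡1+2α) (trans μ≡μ′ μ′≡1+2α′)))
... | inj₁ μ≡2β | inj₂ μ′≡1+2α′ = contradiction (trans (sym μ≡2β) (trans μ≡μ′ μ′≡1+2α′)) (double≢odd β α′)
... | inj₂ μ≡1+2α | inj₁ μ′≡2β′ = contradiction (trans (sym μ′≡2β′) (trans (sym μ≡μ′) μ≡1+2α)) (double≢odd β′ α)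

module Geodesics {n} (X Y Z : Subset n) where

  private
    x y z : Fin n → Bool
    x = lookup X
    y = lookup Y
    z = lookup Z

  α β : ℕ
  α = count (λ i → x i ∧ not (y i) ∧ not (z i))
  β = count (λ i → not (x i) ∧ y i ∧ z i)

  OnGeodesics : Subset n → Set
  OnGeodesics W = dist X W + dist W Y ≡ dist X Y × dist X W + dist W Z ≡ dist X Z

  module _ {W : Subset n} (on-geodesics : OnGeodesics W) where

    private
      w : Fin n → Bool
      w = lookup W

      detours≡0 : ∀ a → a + detour X Y W + detour X Z W ≡ a
      detours≡0 a rewrite on-geodesic⇒detour≡0 X Y W (proj₁ on-geodesics) | on-geodesic⇒detour≡0 X Z W (proj₂ on-geodesics) =
        trans (+-identityʳ _) (+-identityʳ a)

      Detours : (Bool → Bool → Bool → Bool → Bool) → (Bool → Bool → Bool → Bool) → Set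
      Detours f g = ∀ a b c e → χ (f a b c e) ≤ χ (g a b c) + χ (not (a xor b) ∧ (a xor e)) + χ (not (a xor c) ∧ (a xor e))

      count-≤-up-to-detours : ∀ f g → Detours f g →
                              count (λ i → f (x i) (y i) (z i) (w i)) ≤ count (λ i → g (x i) (y i) (z i))
      count-≤-up-to-detours f g f≤g = begin
        count (λ i → f (x i) (y i) (z i) (w i))  ≤⟨ sum-mono-≤ (λ i → f≤g (x i) (y i) (z i) (w i)) ⟩
        ∑[ i < n ] (χ (g (x i) (y i) (z i)) + χ (not (x i xor y i) ∧ (x i xor w i)) + χ (not (x i xor z i) ∧ (x i xor w i)))
          ≡⟨ trans (∑-distrib-+ {n} _ _) (cong (_+ detour X Z W) (∑-distrib-+ {n} _ _)) ⟩
        count (λ i → g (x i) (y i) (z i)) + detour X Y W + detour X Z W  ≡⟨ detours≡0 _ ⟩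
        count (λ i → g (x i) (y i) (z i))        ∎
        where open ≤-Reasoning

    removed≤α : removed X W ≤ α
    removed≤α = count-≤-up-to-detours (λ a _ _ e → a ∧ not e) (λ a b c → a ∧ not b ∧ not c) (≤-by-truth-table 4)

    added≤β : removed W X ≤ β
    added≤β = count-≤-up-to-detours (λ a _ _ e → e ∧ not a) (λ a b c → not a ∧ b ∧ c) (≤-by-truth-table 4)

    dist≤μ : ∀ {m} → ∣ X ∣ ≡ m → ∣ W ∣ ≡ m ⊎ ∣ W ∣ ≡ suc m → dist X W ≤ (β + β) ⊓ suc (α + α)
    dist≤μ ∣X∣≡m ∣W∣ = subst (_≤ _) (sym (dist≡removed+added X W))
      (removal-addition-bound (trans (∣q∣+removed≡∣p∣+added X W) (cong (_+ removed W X) ∣X∣≡m)) ∣W∣ removed≤α added≤β)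

  α+∣X∩Y∣+∣X∩Z∣≡∣X∣+∣X∩Y∩Z∣ : α + ∣ X ∩ Y ∣ + ∣ X ∩ Z ∣ ≡ ∣ X ∣ + ∣ X ∩ (Y ∩ Z) ∣
  α+∣X∩Y∣+∣X∩Z∣≡∣X∣+∣X∩Y∩Z∣ = begin
    α + ∣ X ∩ Y ∣ + ∣ X ∩ Z ∣
      ≡⟨ cong₂ (λ c d → α + c + d) (∣p∩q∣≡count X Y) (∣p∩q∣≡count X Z) ⟩
    α + count (λ i → x i ∧ y i) + count (λ i → x i ∧ z i)
      ≡⟨ cong (_+ count (λ i → x i ∧ z i)) (∑-distrib-+ {n} _ _) ⟨
    ∑[ i < n ] (χ (x i ∧ not (y i) ∧ not (z i)) + χ (x i ∧ y i)) + count (λ i → x i ∧ z i)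
      ≡⟨ ∑-distrib-+ {n} _ _ ⟨
    ∑[ i < n ] (χ (x i ∧ not (y i) ∧ not (z i)) + χ (x i ∧ y i) + χ (x i ∧ z i))
      ≡⟨ sum-cong-≗ (λ i → pointwise (x i) (y i) (z i)) ⟩
    ∑[ i < n ] (χ (x i) + χ (x i ∧ (y i ∧ z i)))          ≡⟨ ∑-distrib-+ {n} _ _ ⟩
    count x + count (λ i → x i ∧ (y i ∧ z i))
      ≡⟨ cong₂ _+_ (∣p∣≡count X) (∣p∩q∩r∣≡count X Y Z) ⟨
    ∣ X ∣ + ∣ X ∩ (Y ∩ Z) ∣                              ∎
    where
    open ≡-Reasoning
    pointwise : ∀ a b c → χ (a ∧ not b ∧ not c) + χ (a ∧ b) + χ (a ∧ c) ≡ χ a + χ (a ∧ (b ∧ c))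
    pointwise = ≡-by-truth-table 3

  β+∣X∩Y∩Z∣≡∣Y∩Z∣ : β + ∣ X ∩ (Y ∩ Z) ∣ ≡ ∣ Y ∩ Z ∣
  β+∣X∩Y∩Z∣≡∣Y∩Z∣ = begin
    β + ∣ X ∩ (Y ∩ Z) ∣                                    ≡⟨ cong (β +_) (∣p∩q∩r∣≡count X Y Z) ⟩
    β + count (λ i → x i ∧ (y i ∧ z i))                    ≡⟨ ∑-distrib-+ {n} _ _ ⟨
    ∑[ i < n ] (χ (not (x i) ∧ y i ∧ z i) + χ (x i ∧ (y i ∧ z i))) ≡⟨ sum-cong-≗ (λ i → pointwise (x i) (y i) (z i)) ⟩
    count (λ i → y i ∧ z i)                                ≡⟨ ∣p∩q∣≡count Y Z ⟨
    ∣ Y ∩ Z ∣                                              ∎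
    where
    open ≡-Reasoning
    pointwise : ∀ a b c → χ (not a ∧ b ∧ c) + χ (a ∧ (b ∧ c)) ≡ χ (b ∧ c)
    pointwise = ≡-by-truth-table 3

  geodesic-vertex-of-shape : ∀ a b → a ≤ α → b ≤ β →
                             Σ (Subset n) λ W → OnGeodesics W × dist X W ≡ a + b × ∣ W ∣ + a ≡ ∣ X ∣ + b
  geodesic-vertex-of-shape a b a≤α b≤β =
    W , (geodesic Y (λ i → geodesic-Y (x i) (y i) (z i) (D i) (A i)) ,
         geodesic Z (λ i → geodesic-Z (x i) (y i) (z i) (D i) (A i))) ,
    dist-X-W , ∣W∣+a≡∣X∣+b
    where
    open ≡-Reasoning
    removable addable : Fin n → Bool
    removable i = x i ∧ not (y i) ∧ not (z i)
    addable   i = not (x i) ∧ y i ∧ z i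
    D A : Fin n → Bool
    D = proj₁ (∃-subset-of-size a removable a≤α)
    A = proj₁ (∃-subset-of-size b addable b≤β)
    -- W is X with the elements chosen by D removed and those chosen by A added.
    move : Bool → Bool → Bool → Bool → Bool → Bool
    move a b c d e = (a ∧ not (d ∧ (a ∧ not b ∧ not c))) ∨ (e ∧ (not a ∧ b ∧ c))
    w : Fin n → Bool
    w i = move (x i) (y i) (z i) (D i) (A i)
    W : Subset n
    W = tabulate w
    dist-X-W : dist X W ≡ a + b
    dist-X-W = begin
      dist X W                                              ≡⟨ sum-cong-≗ (λ i → cong (λ c → χ (x i xor c)) (lookup∘tabulate w i)) ⟩
      ∑[ i < n ] χ (x i xor w i)                            ≡⟨ sum-cong-≗ (λ i → pointwise (x i) (y i) (z i) (D i) (A i)) ⟩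
      ∑[ i < n ] (χ (D i ∧ removable i) + χ (A i ∧ addable i)) ≡⟨ ∑-distrib-+ {n} _ _ ⟩
      count (λ i → D i ∧ removable i) + count (λ i → A i ∧ addable i)
        ≡⟨ cong₂ _+_ (proj₂ (∃-subset-of-size a removable a≤α)) (proj₂ (∃-subset-of-size b addable b≤β)) ⟩
      a + b                                                 ∎
      where
      pointwise : ∀ a b c d e → χ (a xor move a b c d e) ≡ χ (d ∧ (a ∧ not b ∧ not c)) + χ (e ∧ (not a ∧ b ∧ c))
      pointwise = ≡-by-truth-table 5
    ∣W∣+a≡∣X∣+b : ∣ W ∣ + a ≡ ∣ X ∣ + b
    ∣W∣+a≡∣X∣+b = begin
      ∣ W ∣ + a
        ≡⟨ cong₂ _+_ (trans (∣p∣≡count W) (sum-cong-≗ (cong χ ∘ lookup∘tabulate w))) (sym (proj₂ (∃-subset-of-size a removable a≤α))) ⟩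
      count w + count (λ i → D i ∧ removable i) ≡⟨ ∑-distrib-+ {n} _ _ ⟨
      ∑[ i < n ] (χ (w i) + χ (D i ∧ removable i)) ≡⟨ sum-cong-≗ (λ i → pointwise (x i) (y i) (z i) (D i) (A i)) ⟩
      ∑[ i < n ] (χ (x i) + χ (A i ∧ addable i))   ≡⟨ ∑-distrib-+ {n} _ _ ⟩
      count x + count (λ i → A i ∧ addable i)
        ≡⟨ cong₂ _+_ (sym (∣p∣≡count X)) (proj₂ (∃-subset-of-size b addable b≤β)) ⟩
      ∣ X ∣ + b                 ∎
      where
      pointwise : ∀ a b c d e → χ (move a b c d e) + χ (d ∧ (a ∧ not b ∧ not c)) ≡ χ a + χ (e ∧ (not a ∧ b ∧ c))
      pointwise = ≡-by-truth-table 5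
    geodesic : ∀ V → (∀ i → χ (x i xor w i) + χ (w i xor lookup V i) ≡ χ (x i xor lookup V i)) →
               dist X W + dist W V ≡ dist X V
    geodesic V pointwise = begin
      dist X W + dist W V                                          ≡⟨ ∑-distrib-+ {n} _ _ ⟨
      ∑[ i < n ] (χ (x i xor lookup W i) + χ (lookup W i xor lookup V i))
        ≡⟨ sum-cong-≗ (λ i → trans (cong (λ c → χ (x i xor c) + χ (c xor lookup V i)) (lookup∘tabulate w i)) (pointwise i)) ⟩
      dist X V                                                     ∎
    geodesic-Y : ∀ a b c d e → χ (a xor move a b c d e) + χ (move a b c d e xor b) ≡ χ (a xor b)
    geodesic-Y = ≡-by-truth-table 5
    geodesic-Z : ∀ a b c d e → χ (a xor move a b c d e) + χ (move a b c d e xor c) ≡ χ (a xor c)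
    geodesic-Z = ≡-by-truth-table 5

  μ : ℕ
  μ = (β + β) ⊓ suc (α + α)

  μ-attained : ∀ {m} → ∣ X ∣ ≡ m → Σ (Subset n) λ W → (∣ W ∣ ≡ m ⊎ ∣ W ∣ ≡ suc m) × OnGeodesics W × dist X W ≡ μ
  μ-attained {m} ∣X∣≡m with β ≤? α
  ... | yes β≤α =
    let W , geo , d , sizes = geodesic-vertex-of-shape β β β≤α ≤-refl
    in  W , inj₁ (+-cancelʳ-≡ β _ _ (trans sizes (cong (_+ β) ∣X∣≡m))) , geo ,
        trans d (sym (m≤n⇒m⊓n≡m (m≤n⇒m≤1+n (+-mono-≤ β≤α β≤α))))
  ... | no β≰α =
    let α<β = ≰⇒> β≰α
        W , geo , d , sizes = geodesic-vertex-of-shape α (suc α) ≤-refl α<β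
    in  W , inj₂ (+-cancelʳ-≡ α _ _ (trans sizes (trans (cong (_+ suc α) ∣X∣≡m) (+-suc m α)))) , geo ,
        trans d (trans (+-suc α α) (sym (m≥n⇒m⊓n≡n (+-mono-≤ α<β (<⇒≤ α<β)))))

  α+β+∣X∩Y∣+∣X∩Z∣≡∣X∣+∣Y∩Z∣ : α + β + (∣ X ∩ Y ∣ + ∣ X ∩ Z ∣) ≡ ∣ X ∣ + ∣ Y ∩ Z ∣
  α+β+∣X∩Y∣+∣X∩Z∣≡∣X∣+∣Y∩Z∣ = +-cancelʳ-≡ ∣ X ∩ (Y ∩ Z) ∣ _ _ (begin
    α + β + (∣ X ∩ Y ∣ + ∣ X ∩ Z ∣) + t       ≡⟨ rearrange α β (∣ X ∩ Y ∣) (∣ X ∩ Z ∣) t ⟩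
    (α + ∣ X ∩ Y ∣ + ∣ X ∩ Z ∣) + (β + t)     ≡⟨ cong₂ _+_ α+∣X∩Y∣+∣X∩Z∣≡∣X∣+∣X∩Y∩Z∣ β+∣X∩Y∩Z∣≡∣Y∩Z∣ ⟩
    ∣ X ∣ + t + ∣ Y ∩ Z ∣                     ≡⟨ swap-last (∣ X ∣) t (∣ Y ∩ Z ∣) ⟩
    ∣ X ∣ + ∣ Y ∩ Z ∣ + t                     ∎)
    where
    open ≡-Reasoning
    t : ℕ
    t = ∣ X ∩ (Y ∩ Z) ∣
    rearrange : ∀ a b c d e → a + b + (c + d) + e ≡ (a + c + d) + (b + e)
    rearrange = solve-∀
    swap-last : ∀ a b c → a + b + c ≡ a + c + b
    swap-last = solve-∀

-- The stabiliser of x₀ preserves ϱ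

count-toℕ<ᵇ : ∀ n k → k ≤ n → count {n} (λ i → toℕ i <ᵇ k) ≡ k
count-toℕ<ᵇ n       zero    _         = trans (sum-cong-≗ {n} (λ i → cong χ (i<ᵇ0 i))) (sum-replicate-zero n)
  where
  i<ᵇ0 : ∀ {n} (i : Fin n) → (toℕ i <ᵇ 0) ≡ false
  i<ᵇ0 zero    = refl
  i<ᵇ0 (suc i) = refl
count-toℕ<ᵇ (suc n) (suc k) (s≤s k≤n) = cong suc (count-toℕ<ᵇ n k k≤n)

∣x₀∣≡m : ∀ m → ∣ x₀ m ∣ ≡ m
∣x₀∣≡m m = begin
  ∣ x₀ m ∣                               ≡⟨ ∣p∣≡count (x₀ m) ⟩
  count (lookup (x₀ m))                  ≡⟨ sum-cong-≗ {Sz m} (cong χ ∘ lookup∘tabulate (λ i → toℕ i <ᵇ m)) ⟩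
  count {Sz m} (λ i → toℕ i <ᵇ m)        ≡⟨ count-toℕ<ᵇ (Sz m) m (m≤n⇒m≤1+n (m≤m+n m m)) ⟩
  m                                      ∎
  where open ≡-Reasoning

x₀ᵛ : ∀ m → Vertex m
x₀ᵛ m = x₀ m , inj₁ (∣x₀∣≡m m)

module _ {m} (f : Vertex m → Vertex m) (f-isometry : ∀ u v → distᵥ (f u) (f v) ≡ distᵥ u v)
             (f-fixes-x₀ : proj₁ (f (x₀ᵛ m)) ≡ x₀ m) where

  dist-x₀-preserved : ∀ v → dist (x₀ m) (proj₁ (f v)) ≡ dist (x₀ m) (proj₁ v)
  dist-x₀-preserved v = trans (cong (λ p → dist p (proj₁ (f v))) (sym f-fixes-x₀)) (f-isometry (x₀ᵛ m) v)

  μ-≤-μ∘f : ∀ y z → Geodesics.μ (x₀ m) (proj₁ y) (proj₁ z) ≤ Geodesics.μ (x₀ m) (proj₁ (f y)) (proj₁ (f z))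
  μ-≤-μ∘f y z with Geodesics.μ-attained (x₀ m) (proj₁ y) (proj₁ z) (∣x₀∣≡m m)
  ... | W , ∣W∣ , (geoY , geoZ) , d =
    subst (_≤ Geodesics.μ (x₀ m) (proj₁ (f y)) (proj₁ (f z))) (trans (dist-x₀-preserved w) d)
      (Geodesics.dist≤μ (x₀ m) (proj₁ (f y)) (proj₁ (f z)) {proj₁ (f w)} (transport y geoY , transport z geoZ)
                        (∣x₀∣≡m m) (proj₂ (f w)))
    where
    w : Vertex m
    w = W , ∣W∣
    transport : ∀ v → dist (x₀ m) W + distᵥ w v ≡ dist (x₀ m) (proj₁ v) →
                dist (x₀ m) (proj₁ (f w)) + distᵥ (f w) (f v) ≡ dist (x₀ m) (proj₁ (f v))
    transport v geo = trans (cong₂ _+_ (dist-x₀-preserved w) (f-isometry w v)) (trans geo (sym (dist-x₀-preserved v)))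

module Stabiliser {m} (σ : Aut m) (σ-fixes-x₀ : InStab σ) where

  open Inverse (⤖⇒↔ (Aut.bij σ)) public using (to; from; strictlyInverseˡ; strictlyInverseʳ)

  to-isometry : ∀ u v → distᵥ (to u) (to v) ≡ distᵥ u v
  to-isometry = Aut-preserves-distᵥ σ

  to-fixes-x₀ : proj₁ (to (x₀ᵛ m)) ≡ x₀ m
  to-fixes-x₀ = σ-fixes-x₀ (x₀ᵛ m) refl

  from-isometry : ∀ u v → distᵥ (from u) (from v) ≡ distᵥ u v
  from-isometry u v = trans (sym (to-isometry (from u) (from v))) (cong₂ distᵥ (strictlyInverseˡ u) (strictlyInverseˡ v))

  from-fixes-x₀ : proj₁ (from (x₀ᵛ m)) ≡ x₀ m
  from-fixes-x₀ = cong proj₁ (trans (cong from (sym (Vertex-≡ to-fixes-x₀))) (strictlyInverseʳ (x₀ᵛ m)))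

  μ-preserved : ∀ y z → Geodesics.μ (x₀ m) (proj₁ y) (proj₁ z) ≡ Geodesics.μ (x₀ m) (proj₁ (to y)) (proj₁ (to z))
  μ-preserved y z = ≤-antisym (μ-≤-μ∘f to to-isometry to-fixes-x₀ y z)
    (subst₂ (λ u v → Geodesics.μ (x₀ m) (proj₁ (to y)) (proj₁ (to z)) ≤ Geodesics.μ (x₀ m) (proj₁ u) (proj₁ v))
            (strictlyInverseʳ y) (strictlyInverseʳ z)
            (μ-≤-μ∘f from from-isometry from-fixes-x₀ (to y) (to z)))

∣X∩Y∩Z∣-determined-by-μ : ∀ {n} (X Y Z Y′ Z′ : Subset n) →
                          ∣ X ∩ Y ∣ ≡ ∣ X ∩ Y′ ∣ → ∣ X ∩ Z ∣ ≡ ∣ X ∩ Z′ ∣ → ∣ Y ∩ Z ∣ ≡ ∣ Y′ ∩ Z′ ∣ →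
                          Geodesics.μ X Y Z ≡ Geodesics.μ X Y′ Z′ → ∣ X ∩ (Y ∩ Z) ∣ ≡ ∣ X ∩ (Y′ ∩ Z′) ∣
∣X∩Y∩Z∣-determined-by-μ X Y Z Y′ Z′ ∣X∩Y∣≡ ∣X∩Z∣≡ ∣Y∩Z∣≡ μ≡μ′ = +-cancelˡ-≡ ∣ X ∣ _ _ (begin
  ∣ X ∣ + ∣ X ∩ (Y ∩ Z) ∣          ≡⟨ G.α+∣X∩Y∣+∣X∩Z∣≡∣X∣+∣X∩Y∩Z∣ ⟨
  G.α + ∣ X ∩ Y ∣ + ∣ X ∩ Z ∣      ≡⟨ cong₂ (λ a c → a + c + ∣ X ∩ Z ∣) (μ-injective α+β≡α′+β′ μ≡μ′) ∣X∩Y∣≡ ⟩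
  G′.α + ∣ X ∩ Y′ ∣ + ∣ X ∩ Z ∣    ≡⟨ cong (G′.α + ∣ X ∩ Y′ ∣ +_) ∣X∩Z∣≡ ⟩
  G′.α + ∣ X ∩ Y′ ∣ + ∣ X ∩ Z′ ∣   ≡⟨ G′.α+∣X∩Y∣+∣X∩Z∣≡∣X∣+∣X∩Y∩Z∣ ⟩
  ∣ X ∣ + ∣ X ∩ (Y′ ∩ Z′) ∣        ∎)
  where
  open ≡-Reasoning
  module G  = Geodesics X Y Z
  module G′ = Geodesics X Y′ Z′
  α+β≡α′+β′ : G.α + G.β ≡ G′.α + G′.β
  α+β≡α′+β′ = +-cancelʳ-≡ (∣ X ∩ Y ∣ + ∣ X ∩ Z ∣) _ _ (begin
    G.α + G.β + (∣ X ∩ Y ∣ + ∣ X ∩ Z ∣)     ≡⟨ G.α+β+∣X∩Y∣+∣X∩Z∣≡∣X∣+∣Y∩Z∣ ⟩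
    ∣ X ∣ + ∣ Y ∩ Z ∣                       ≡⟨ cong (∣ X ∣ +_) ∣Y∩Z∣≡ ⟩
    ∣ X ∣ + ∣ Y′ ∩ Z′ ∣                     ≡⟨ G′.α+β+∣X∩Y∣+∣X∩Z∣≡∣X∣+∣Y∩Z∣ ⟨
    G′.α + G′.β + (∣ X ∩ Y′ ∣ + ∣ X ∩ Z′ ∣) ≡⟨ cong (G′.α + G′.β +_) (cong₂ _+_ ∣X∩Y∣≡ ∣X∩Z∣≡) ⟨
    G′.α + G′.β + (∣ X ∩ Y ∣ + ∣ X ∩ Z ∣)   ∎)

ϱ-invariant : ∀ {m} (y z y′ z′ : Vertex m) → ∣ proj₁ y ∣ ≡ ∣ proj₁ y′ ∣ → ∣ proj₁ z ∣ ≡ ∣ proj₁ z′ ∣ →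
              SameOrbit y z y′ z′ → ϱ y z ≡ ϱ y′ z′
ϱ-invariant {m} y@(Y , _) z@(Z , _) _ _ ∣y∣≡∣y′∣ ∣z∣≡∣z′∣ (σ , σ-fixes-x₀ , refl , refl) =
  cong₂ _,_ ∣X∩Y∣≡ (cong₂ _,_ ∣X∩Z∣≡ (cong₂ _,_ ∣Y∩Z∣≡
    (∣X∩Y∩Z∣-determined-by-μ X Y Z Y′ Z′ ∣X∩Y∣≡ ∣X∩Z∣≡ ∣Y∩Z∣≡ (μ-preserved y z))))
  where
  open Stabiliser σ σ-fixes-x₀
  X Y′ Z′ : Subset (Sz m)
  X  = x₀ m
  Y′ = proj₁ (to y)
  Z′ = proj₁ (to z)
  ∣X∩Y∣≡ : ∣ X ∩ Y ∣ ≡ ∣ X ∩ Y′ ∣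
  ∣X∩Y∣≡ = ∣p∩q∣-determined-by-dist X Y X Y′ (cong (∣ X ∣ +_) ∣y∣≡∣y′∣) (sym (dist-x₀-preserved to to-isometry to-fixes-x₀ y))
  ∣X∩Z∣≡ : ∣ X ∩ Z ∣ ≡ ∣ X ∩ Z′ ∣
  ∣X∩Z∣≡ = ∣p∩q∣-determined-by-dist X Z X Z′ (cong (∣ X ∣ +_) ∣z∣≡∣z′∣) (sym (dist-x₀-preserved to to-isometry to-fixes-x₀ z))
  ∣Y∩Z∣≡ : ∣ Y ∩ Z ∣ ≡ ∣ Y′ ∩ Z′ ∣
  ∣Y∩Z∣≡ = ∣p∩q∣-determined-by-dist Y Z Y′ Z′ (cong₂ _+_ ∣y∣≡∣y′∣ ∣z∣≡∣z′∣) (sym (to-isometry y z))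

-- Equal ϱ is realised by a permutation of S fixing x₀

module _ {a} {A : Set a} (_≟ᴬ_ : DecidableEquality A) where

  fibre : ∀ {n} → (Fin n → A) → A → ℕ
  fibre f c = count (λ i → ⌊ f i ≟ᴬ c ⌋)

  fibre-of-head : ∀ {n} (g : Fin (suc n) → A) → 0 < fibre g (g zero)
  fibre-of-head g = subst (λ b → 0 < χ b + fibre (g ∘ suc) (g zero)) (sym (Equivalence.to T-≡ (fromWitness refl))) (s≤s z≤n)

  equal-fibres-after-removal : ∀ {n} (f g : Fin (suc n) → A) i → f i ≡ g zero → (∀ c → fibre f c ≡ fibre g c) →
                               ∀ c → fibre (f ∘ punchIn i) c ≡ fibre (g ∘ suc) c
  equal-fibres-after-removal f g i fᵢ≡g₀ fibres c = +-cancelˡ-≡ (χ ⌊ g zero ≟ᴬ c ⌋) _ _ (begin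
    χ ⌊ g zero ≟ᴬ c ⌋ + fibre (f ∘ punchIn i) c ≡⟨ cong (λ a → χ ⌊ a ≟ᴬ c ⌋ + fibre (f ∘ punchIn i) c) fᵢ≡g₀ ⟨
    χ ⌊ f i ≟ᴬ c ⌋ + fibre (f ∘ punchIn i) c    ≡⟨ sum-remove {i = i} (λ j → χ ⌊ f j ≟ᴬ c ⌋) ⟨
    fibre f c                                   ≡⟨ fibres c ⟩
    fibre g c                                   ∎)
    where open ≡-Reasoning

  equal-fibres⇒permutation : ∀ {n} (f g : Fin n → A) → (∀ c → fibre f c ≡ fibre g c) →
                             Σ (Permutation n n) λ π → ∀ i → f (π ⟨$⟩ʳ i) ≡ g i
  equal-fibres⇒permutation {zero}  f g _ = Perm.id , λ ()
  equal-fibres⇒permutation {suc n} f g fibres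
    with i₀ , fi₀≟g₀ ← count>0⇒∃ (λ i → ⌊ f i ≟ᴬ g zero ⌋) (subst (0 <_) (sym (fibres (g zero))) (fibre-of-head g))
    with π , π-matches ← equal-fibres⇒permutation (f ∘ punchIn i₀) (g ∘ suc)
                           (equal-fibres-after-removal f g i₀ (toWitness fi₀≟g₀) fibres) =
    Perm.insert zero i₀ π , λ where
      zero    → toWitness fi₀≟g₀
      (suc i) → trans (cong f (Perm.insert-punchIn zero i₀ π i)) (π-matches i)

relabel : ∀ {n} → Permutation n n → Subset n → Subset n
relabel π p = tabulate (λ i → lookup p (π ⟨$⟩ʳ i))

lookup-relabel : ∀ {n} (π : Permutation n n) p i → lookup (relabel π p) i ≡ lookup p (π ⟨$⟩ʳ i)
lookup-relabel π p = lookup∘tabulate (λ i → lookup p (π ⟨$⟩ʳ i))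

∣relabel∣ : ∀ {n} (π : Permutation n n) p → ∣ relabel π p ∣ ≡ ∣ p ∣
∣relabel∣ π p = begin
  ∣ relabel π p ∣                     ≡⟨ ∣p∣≡count (relabel π p) ⟩
  count (lookup (relabel π p))        ≡⟨ sum-cong-≗ (cong χ ∘ lookup-relabel π p) ⟩
  count (λ i → lookup p (π ⟨$⟩ʳ i))   ≡⟨ sum-permute (χ ∘ lookup p) π ⟨
  count (lookup p)                    ≡⟨ ∣p∣≡count p ⟨
  ∣ p ∣                               ∎
  where open ≡-Reasoning

relabel-inverse : ∀ {n} (π ρ : Permutation n n) → (∀ i → ρ ⟨$⟩ʳ (π ⟨$⟩ʳ i) ≡ i) → ∀ p → relabel π (relabel ρ p) ≡ p
relabel-inverse π ρ ρ∘π≗id p = lookup-injective λ i → begin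
  lookup (relabel π (relabel ρ p)) i  ≡⟨ lookup-relabel π (relabel ρ p) i ⟩
  lookup (relabel ρ p) (π ⟨$⟩ʳ i)     ≡⟨ lookup-relabel ρ p _ ⟩
  lookup p (ρ ⟨$⟩ʳ (π ⟨$⟩ʳ i))        ≡⟨ cong (lookup p) (ρ∘π≗id i) ⟩
  lookup p i                          ∎
  where open ≡-Reasoning

relabel-≡ : ∀ {n} (π : Permutation n n) {p q : Subset n} → (∀ i → lookup p (π ⟨$⟩ʳ i) ≡ lookup q i) → relabel π p ≡ q
relabel-≡ π {p} eq = lookup-injective λ i → trans (lookup-relabel π p i) (eq i)

relabel-⊆ : ∀ {n} (π : Permutation n n) {p q} → p ⊆ q → relabel π p ⊆ relabel π q
relabel-⊆ π {p} {q} p⊆q = lookup⇒⊆ λ i pᵢ →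
  trans (lookup-relabel π q i) (⊆⇒lookup p⊆q _ (trans (sym (lookup-relabel π p i)) pᵢ))

relabelᵥ : ∀ {m} → Permutation (Sz m) (Sz m) → Vertex m → Vertex m
relabelᵥ {m} π (p , size) = relabel π p , subst (λ k → k ≡ m ⊎ k ≡ suc m) (sym (∣relabel∣ π p)) size

Adj-relabelᵥ : ∀ {m} (π π⁻¹ : Permutation (Sz m) (Sz m)) → (∀ p → relabel π⁻¹ (relabel π p) ≡ p) →
               ∀ (u v : Vertex m) → Adj u v → Adj (relabelᵥ π u) (relabelᵥ π v)
Adj-relabelᵥ π π⁻¹ π⁻¹∘π≗id (p , _) (q , _) (p≢q , inclusion) =
  (λ πp≡πq → p≢q (trans (sym (π⁻¹∘π≗id p)) (trans (cong (relabel π⁻¹) πp≡πq) (π⁻¹∘π≗id q)))) ,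
  Sum.map (relabel-⊆ π) (relabel-⊆ π) inclusion

relabel-Aut : ∀ {m} → Permutation (Sz m) (Sz m) → Aut m
relabel-Aut {m} π = record
  { bij = ↔⇒⤖ (mk↔ₛ′ (relabelᵥ π) (relabelᵥ π⁻¹)
                      (Vertex-≡ ∘ π∘π⁻¹≗id ∘ proj₁) (Vertex-≡ ∘ π⁻¹∘π≗id ∘ proj₁))
  ; adj = λ u v → mk⇔ (Adj-relabelᵥ π π⁻¹ π⁻¹∘π≗id u v) (reflect u v)
  }
  where
  π⁻¹ : Permutation (Sz m) (Sz m)
  π⁻¹ = Perm.flip π
  π⁻¹∘π≗id : ∀ p → relabel π⁻¹ (relabel π p) ≡ p
  π⁻¹∘π≗id = relabel-inverse π⁻¹ π (λ _ → Perm.inverseʳ π)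
  π∘π⁻¹≗id : ∀ p → relabel π (relabel π⁻¹ p) ≡ p
  π∘π⁻¹≗id = relabel-inverse π π⁻¹ (λ _ → Perm.inverseˡ π)
  reflect : ∀ u v → Adj (relabelᵥ π u) (relabelᵥ π v) → Adj u v
  reflect u v πu~πv =
    subst₂ Adj {relabelᵥ π⁻¹ (relabelᵥ π u)} {u} {relabelᵥ π⁻¹ (relabelᵥ π v)} {v}
      (Vertex-≡ (π⁻¹∘π≗id (proj₁ u))) (Vertex-≡ (π⁻¹∘π≗id (proj₁ v)))
      (Adj-relabelᵥ π⁻¹ π π∘π⁻¹≗id (relabelᵥ π u) (relabelᵥ π v) πu~πv)

Pattern : Set
Pattern = Bool × Bool × Bool

_≟ᵖ_ : DecidableEquality Pattern
_≟ᵖ_ = ≡-dec _≟ᵇ_ (≡-dec _≟ᵇ_ _≟ᵇ_)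

Region : Set
Region = Bool → Bool → Bool → Bool

cell : Pattern → Region
cell c a b d = ⌊ (a , b , d) ≟ᵖ c ⌋

data Statistic : Set where
  #X #Y #Z #XY #XZ #YZ #XYZ #all : Statistic

region : Statistic → Region
region #X   a _ _ = a
region #Y   _ b _ = b
region #Z   _ _ d = d
region #XY  a b _ = a ∧ b
region #XZ  a _ d = a ∧ d
region #YZ  _ b d = b ∧ d
region #XYZ a b d = a ∧ (b ∧ d)
region #all _ _ _ = true

-- Inclusion–exclusion: the Venn region c of (X, Y, Z) has size Σ (upper c) − Σ (lower c).
lower upper : Pattern → List Statistic
lower (true  , true  , true ) = []
lower (true  , true  , false) = #XYZ ∷ []
lower (true  , false , true ) = #XYZ ∷ []
lower (false , true  , true ) = #XYZ ∷ []
lower (true  , false , false) = #XY ∷ #XZ ∷ []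
lower (false , true  , false) = #XY ∷ #YZ ∷ []
lower (false , false , true ) = #XZ ∷ #YZ ∷ []
lower (false , false , false) = #X ∷ #Y ∷ #Z ∷ #XYZ ∷ []
upper (true  , true  , true ) = #XYZ ∷ []
upper (true  , true  , false) = #XY ∷ []
upper (true  , false , true ) = #XZ ∷ []
upper (false , true  , true ) = #YZ ∷ []
upper (true  , false , false) = #X ∷ #XYZ ∷ []
upper (false , true  , false) = #Y ∷ #XYZ ∷ []
upper (false , false , true ) = #Z ∷ #XYZ ∷ []
upper (false , false , false) = #all ∷ #XY ∷ #XZ ∷ #YZ ∷ []

χ-total : List Region → Bool → Bool → Bool → ℕ
χ-total φs a b d = foldr (λ φ s → χ (φ a b d) + s) 0 φs

inclusion-exclusion-table : ∀ c a b d → χ-total (cell c ∷ map region (lower c)) a b d ≡ χ-total (map region (upper c)) a b d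
inclusion-exclusion-table (true  , true  , true ) = ≡-by-truth-table 3
inclusion-exclusion-table (true  , true  , false) = ≡-by-truth-table 3
inclusion-exclusion-table (true  , false , true ) = ≡-by-truth-table 3
inclusion-exclusion-table (false , true  , true ) = ≡-by-truth-table 3
inclusion-exclusion-table (true  , false , false) = ≡-by-truth-table 3
inclusion-exclusion-table (false , true  , false) = ≡-by-truth-table 3
inclusion-exclusion-table (false , false , true ) = ≡-by-truth-table 3
inclusion-exclusion-table (false , false , false) = ≡-by-truth-table 3

module Venn {n} (X Y Z : Subset n) where

  pattern-at : Fin n → Pattern
  pattern-at i = lookup X i , lookup Y i , lookup Z i

  #_ : Region → ℕ
  # φ = count (λ i → φ (lookup X i) (lookup Y i) (lookup Z i))

  total : List Region → ℕ
  total = foldr (λ φ s → # φ + s) 0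

  total≡sum : ∀ φs → total φs ≡ ∑[ i < n ] χ-total φs (lookup X i) (lookup Y i) (lookup Z i)
  total≡sum []       = sym (sum-replicate-zero n)
  total≡sum (φ ∷ φs) = trans (cong (# φ +_) (total≡sum φs)) (sym (∑-distrib-+ {n} _ _))

  total-≡ : ∀ φs ψs → (∀ a b d → χ-total φs a b d ≡ χ-total ψs a b d) → total φs ≡ total ψs
  total-≡ φs ψs eq = trans (total≡sum φs) (trans (sum-cong-≗ λ i → eq (lookup X i) (lookup Y i) (lookup Z i)) (sym (total≡sum ψs)))

  statistics : List Statistic → ℕ
  statistics ss = total (map region ss)

  inclusion-exclusion : ∀ c → fibre _≟ᵖ_ pattern-at c + statistics (lower c) ≡ statistics (upper c)
  inclusion-exclusion c = total-≡ (cell c ∷ map region (lower c)) (map region (upper c)) (inclusion-exclusion-table c)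

  statistic : Statistic → ℕ
  statistic #X   = ∣ X ∣
  statistic #Y   = ∣ Y ∣
  statistic #Z   = ∣ Z ∣
  statistic #XY  = ∣ X ∩ Y ∣
  statistic #XZ  = ∣ X ∩ Z ∣
  statistic #YZ  = ∣ Y ∩ Z ∣
  statistic #XYZ = ∣ X ∩ (Y ∩ Z) ∣
  statistic #all = n

  #region≡statistic : ∀ s → # region s ≡ statistic s
  #region≡statistic #X   = sym (∣p∣≡count X)
  #region≡statistic #Y   = sym (∣p∣≡count Y)
  #region≡statistic #Z   = sym (∣p∣≡count Z)
  #region≡statistic #XY  = sym (∣p∩q∣≡count X Y)
  #region≡statistic #XZ  = sym (∣p∩q∣≡count X Z)
  #region≡statistic #YZ  = sym (∣p∩q∣≡count Y Z)
  #region≡statistic #XYZ = sym (∣p∩q∩r∣≡count X Y Z)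
  #region≡statistic #all = count-true n
    where
    count-true : ∀ n → count {n} (λ _ → true) ≡ n
    count-true zero    = refl
    count-true (suc n) = cong suc (count-true n)

regions-determined : ∀ {n} (X Y Z X′ Y′ Z′ : Subset n) →
                     (∀ s → Venn.statistic X Y Z s ≡ Venn.statistic X′ Y′ Z′ s) →
                     ∀ c → fibre _≟ᵖ_ (Venn.pattern-at X Y Z) c ≡ fibre _≟ᵖ_ (Venn.pattern-at X′ Y′ Z′) c
regions-determined X Y Z X′ Y′ Z′ same c = +-cancelʳ-≡ (V.statistics (lower c)) _ _ (begin
  fibre _≟ᵖ_ V.pattern-at c + V.statistics (lower c)    ≡⟨ V.inclusion-exclusion c ⟩
  V.statistics (upper c)                                ≡⟨ same-statistics (upper c) ⟩
  V′.statistics (upper c)                               ≡⟨ V′.inclusion-exclusion c ⟨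
  fibre _≟ᵖ_ V′.pattern-at c + V′.statistics (lower c)  ≡⟨ cong (fibre _≟ᵖ_ V′.pattern-at c +_) (same-statistics (lower c)) ⟨
  fibre _≟ᵖ_ V′.pattern-at c + V.statistics (lower c)   ∎)
  where
  open ≡-Reasoning
  module V  = Venn X Y Z
  module V′ = Venn X′ Y′ Z′
  same-statistics : ∀ ss → V.statistics ss ≡ V′.statistics ss
  same-statistics []       = refl
  same-statistics (s ∷ ss) =
    cong₂ _+_ (trans (V.#region≡statistic s) (trans (same s) (sym (V′.#region≡statistic s)))) (same-statistics ss)

ϱ-complete : ∀ {m} (y z y′ z′ : Vertex m) → ∣ proj₁ y ∣ ≡ ∣ proj₁ y′ ∣ → ∣ proj₁ z ∣ ≡ ∣ proj₁ z′ ∣ →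
             ϱ y z ≡ ϱ y′ z′ → SameOrbit y z y′ z′
ϱ-complete {m} y@(Y , _) z@(Z , _) y′@(Y′ , _) z′@(Z′ , _) ∣y∣≡∣y′∣ ∣z∣≡∣z′∣ ϱ≡ϱ′ =
  relabel-Aut π , fixes-x₀ , Vertex-≡ (relabel-≡ π {Y} (cong (proj₁ ∘ proj₂) ∘ matches)) ,
                           Vertex-≡ (relabel-≡ π {Z} (cong (proj₂ ∘ proj₂) ∘ matches))
  where
  X : Subset (Sz m)
  X = x₀ m
  same : ∀ s → Venn.statistic X Y Z s ≡ Venn.statistic X Y′ Z′ s
  same #X   = refl
  same #Y   = ∣y∣≡∣y′∣
  same #Z   = ∣z∣≡∣z′∣
  same #XY  = cong proj₁ ϱ≡ϱ′
  same #XZ  = cong (proj₁ ∘ proj₂) ϱ≡ϱ′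
  same #YZ  = cong (proj₁ ∘ proj₂ ∘ proj₂) ϱ≡ϱ′
  same #XYZ = cong (proj₂ ∘ proj₂ ∘ proj₂) ϱ≡ϱ′
  same #all = refl
  matching : Σ (Permutation (Sz m) (Sz m)) λ π → ∀ i → Venn.pattern-at X Y Z (π ⟨$⟩ʳ i) ≡ Venn.pattern-at X Y′ Z′ i
  matching = equal-fibres⇒permutation _≟ᵖ_ (Venn.pattern-at X Y Z) (Venn.pattern-at X Y′ Z′) (regions-determined X Y Z X Y′ Z′ same)
  π : Permutation (Sz m) (Sz m)
  π = proj₁ matching
  matches : ∀ i → Venn.pattern-at X Y Z (π ⟨$⟩ʳ i) ≡ Venn.pattern-at X Y′ Z′ i
  matches = proj₂ matching
  fixes-x₀ : InStab (relabel-Aut π)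
  fixes-x₀ v refl = relabel-≡ π {X} (cong proj₁ ∘ matches)

proposition3p2 : (m : ℕ) → 1 ≤ m → (a b : ℕ) → (a ≡ m ⊎ a ≡ suc m) → (b ≡ m ⊎ b ≡ suc m)
    → (y z y′ z′ : Vertex m)
    → ∣ proj₁ y ∣ ≡ a → ∣ proj₁ z ∣ ≡ b → ∣ proj₁ y′ ∣ ≡ a → ∣ proj₁ z′ ∣ ≡ b
    → SameOrbit y z y′ z′ ⇔ (ϱ y z ≡ ϱ y′ z′)
proposition3p2 m _ a b _ _ y z y′ z′ ∣y∣≡a ∣z∣≡b ∣y′∣≡a ∣z′∣≡b =
  mk⇔ (ϱ-invariant y z y′ z′ ∣y∣≡∣y′∣ ∣z∣≡∣z′∣) (ϱ-complete y z y′ z′ ∣y∣≡∣y′∣ ∣z∣≡∣z′∣)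
  where
  ∣y∣≡∣y′∣ : ∣ proj₁ y ∣ ≡ ∣ proj₁ y′ ∣
  ∣y∣≡∣y′∣ = trans ∣y∣≡a (sym ∣y′∣≡a)
  ∣z∣≡∣z′∣ : ∣ proj₁ z ∣ ≡ ∣ proj₁ z′ ∣
  ∣z∣≡∣z′∣ = trans ∣z∣≡b (sym ∣z′∣≡b)
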